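{- Assume the setting described in the context. Suppose that for every object $X$ and all morphisms $\phi:\overline{F}^{*}X\multimap\overline{F}^{*}X$ and $\psi:\overline{F_\tau}X\multimap\overline{F_\tau}X$ in $\mathcal{K}l(T)$, if $\psi\cdot h_X=h_X\cdot\phi$ then $\psi^{*}\cdot h_X=h_X\cdot\phi^{*}$. Then for every $\alpha:X\multimap\overline{F_\tau}X$ we have $h_X\cdot\underline{\alpha}^{\divideontimes}=\alpha^{\bigstar}$.
   Context: Let $\mathsf{C}$ be a category with binary coproducts and $(T,\mu,\eta)$ a monad on $\mathsf{C}$. In the Kleisli category $\mathcal{K}l(T)$ (objects of $\mathsf{C}$; morphisms $X\multimap Y$ are $\mathsf{C}$-morphisms $X\to TY$; composition $g\cdot f=\mu_Z\circ Tg\circ f$; identity $1_X=\eta_X$) write $f^\sharp=\eta_Y\circ f$ for $f:X\to Y$ in $\mathsf{C}$; coproducts of $\mathcal{K}l(T)$ are those of $\mathsf{C}$, with coprojections $\iota^1,\iota^2$ and cotupling $[-,-]$. $\mathcal{K}l(T)$ is order-enriched (hom-sets are posets, composition monotone) and $T$ is an order saturation monad: for every $\alpha:X\multimap X$ there is $\alpha^{*}:X\multimap X$ with (a) $1\le\alpha^*$, (b) $\alpha\le\alpha^*$, (c) $\alpha^*\cdot\alpha^*\le\alpha^*$, (d) if $\beta:X\multimap X$ satisfies $1\le\beta$, $\alpha\le\beta$, $\beta\cdot\beta\le\beta$ then $\alpha^*\le\beta$, (e) for all $f:X\to Y$ in $\mathsf{C}$, $\beta:Y\multimap Y$ and $\Box\in\{\le,\ge\}$: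 $f^\sharp\cdot\alpha\mathrel{\Box}\beta\cdot f^\sharp$ implies $f^\sharp\cdot\alpha^*\mathrel{\Box}\beta^*\cdot f^\sharp$. A functor $S$ on $\mathsf{C}$ lifts to $\overline{S}$ on $\mathcal{K}l(T)$ if $\overline{S}X=SX$ and $\overline{S}(f^\sharp)=(Sf)^\sharp$; if $(\overline{S},m,e)$ is a monad on $\mathcal{K}l(T)$ then $TS$ is a monad on $\mathsf{C}$ whose Kleisli category is $\mathcal{K}l(\overline{S})$, with hom-sets $Hom_{\mathcal{K}l(T)}(X,\overline{S}Y)$ ordered as in $\mathcal{K}l(T)$. Standing assumptions: $\mathcal{K}l(T)$ has zero morphisms $0_{X,Y}$ (with $f\cdot 0=0=0\cdot g$). $F:\mathsf{C}\to\mathsf{C}$ lifts to $\overline{F}$, so $F_\tau=F+\mathcal{I}d$ lifts to $\overline{F_\tau}=\overline{F}+\mathcal{I}d$, which is a monad $(\overline{F_\tau},m',e')$ on $\mathcal{K}l(T)$ with $e'_X=\iota^2:X\multimap\overline{F}X+X$ and $m'_X=[\iota^1,id]\cdot(\overline{F}([0,id])+id):\overline{F}(\overline{F}X+X)+(\overline{F}X+X)\multimap\overline{F}X+X$. $F$ admits all free $F$-algebras, giving the free monad $F^*$ on $\mathsf{C}$; it lifts to $\overline{F}^*$ on $\mathcal{K}l(T)$ and $(\overline{F}^*,m,e)$ is the free monad over $\overline{F}$ in $\mathcal{K}l(T)$ with universal natural transformation $\nu:\overline{F}\Rightarrow\overline{F}^*$. For both $(\overline{S},m,e)=(\overline{F_\tau},m',e')$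 and $(\overline{S},m,e)=(\overline{F}^*,m,e)$, $\overline{S}$ is locally monotonic and $m_X\cdot\overline{S}[(m_X\cdot\overline{S}\alpha)^*\cdot e_X]=(m_X\cdot\overline{S}\alpha)^*$ for all $\alpha:X\multimap\overline{S}X$. For $\alpha:X\multimap\overline{F_\tau}X$ put $\alpha^{\bigstar}=(m'_X\cdot\overline{F_\tau}\alpha)^*\cdot e'_X$, and for $\beta:Y\multimap\overline{F}^*Y$ put $\beta^{\divideontimes}=(m_Y\cdot\overline{F}^*\beta)^*\cdot e_Y$ (these are saturation operators making $TF_\tau$ and $TF^*$ order saturation monads). $h:\overline{F}^*\Rightarrow\overline{F_\tau}$ is the unique monad morphism on $\mathcal{K}l(T)$ with $h\cdot\nu=\iota^1$ (it also satisfies $h\cdot e=e'$ and $h\cdot[\nu,e]=id$). For $\alpha:X\multimap\overline{F_\tau}X$ let $\underline{\alpha}=[\nu_X,e_X]\cdot\alpha:X\multimap\overline{F}^*X$. -}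

module Defs where

open import Level using (Level; _⊔_) renaming (suc to lsuc)
open import Relation.Binary.PropositionalEquality using (_≡_)
open import Relation.Binary.Structures using (IsPartialOrder)
open import Data.Product using (Σ; _×_)

record RawCat (o ℓ : Level) : Set (lsuc (o ⊔ ℓ)) where
  infixr 9 _∘_
  field
    Obj : Set o
    Hom : Obj → Obj → Set ℓ
    id  : ∀ {A} → Hom A A
    _∘_ : ∀ {A B C} → Hom B C → Hom A B → Hom A C

module _ {o ℓ : Level} (C : RawCat o ℓ) where
  open RawCat C

  record IsCategory : Set (o ⊔ ℓ) where
    field
      identityˡ : ∀ {A B} (f : Hom A B) → id ∘ f ≡ f
      identityʳ : ∀ {A B} (f : Hom A B) → f ∘ id ≡ f
      assoc     : ∀ {A B C D} (f : Hom A B) (g : Hom B C) (h : Hom C D) →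
                  (h ∘ g) ∘ f ≡ h ∘ (g ∘ f)

  record RawEndo : Set (o ⊔ ℓ) where
    field
      F₀ : Obj → Obj
      F₁ : ∀ {A B} → Hom A B → Hom (F₀ A) (F₀ B)

  record IsFunctor (F : RawEndo) : Set (o ⊔ ℓ) where
    open RawEndo F
    field
      F-id : ∀ {A} → F₁ (id {A}) ≡ id
      F-∘  : ∀ {A B D} (f : Hom A B) (g : Hom B D) → F₁ (g ∘ f) ≡ F₁ g ∘ F₁ f

  IsNatural : (F G : RawEndo) → (∀ X → Hom (RawEndo.F₀ F X) (RawEndo.F₀ G X)) → Set (o ⊔ ℓ)
  IsNatural F G θ = ∀ {X Y} (f : Hom X Y) →
    θ Y ∘ RawEndo.F₁ F f ≡ RawEndo.F₁ G f ∘ θ X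

  record RawMonad : Set (o ⊔ ℓ) where
    field
      endo : RawEndo
    open RawEndo endo public
    field
      unit : ∀ X → Hom X (F₀ X)
      mult : ∀ X → Hom (F₀ (F₀ X)) (F₀ X)

  record IsMonad (M : RawMonad) : Set (o ⊔ ℓ) where
    open RawMonad M
    field
      functor    : IsFunctor endo
      unit-nat   : ∀ {X Y} (f : Hom X Y) → unit Y ∘ f ≡ F₁ f ∘ unit X
      mult-nat   : ∀ {X Y} (f : Hom X Y) → mult Y ∘ F₁ (F₁ f) ≡ F₁ f ∘ mult X
      unit-left  : ∀ X → mult X ∘ F₁ (unit X) ≡ id
      unit-right : ∀ X → mult X ∘ unit (F₀ X) ≡ id
      mult-assoc : ∀ X → mult X ∘ F₁ (mult X) ≡ mult X ∘ mult (F₀ X)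

  record IsMonadMorphism (M N : RawMonad)
         (θ : ∀ X → Hom (RawMonad.F₀ M X) (RawMonad.F₀ N X)) : Set (o ⊔ ℓ) where
    private
      module M = RawMonad M
      module N = RawMonad N
    field
      natural  : IsNatural M.endo N.endo θ
      pres-unit : ∀ X → θ X ∘ M.unit X ≡ N.unit X
      pres-mult : ∀ X → θ X ∘ M.mult X ≡ N.mult X ∘ (N.F₁ (θ X) ∘ θ (M.F₀ X))

  record IsFreeMonadOver (G : RawEndo) (M : RawMonad)
         (ν : ∀ X → Hom (RawEndo.F₀ G X) (RawMonad.F₀ M X)) : Set (o ⊔ ℓ) where
    field
      isMonad : IsMonad M
      ν-nat   : IsNatural G (RawMonad.endo M) ν
      univ    : (N : RawMonad) → IsMonad N →
                (σ : ∀ X → Hom (RawEndo.F₀ G X) (RawMonad.F₀ N X)) →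
                IsNatural G (RawMonad.endo N) σ →
                Σ (∀ X → Hom (RawMonad.F₀ M X) (RawMonad.F₀ N X)) λ θ →
                  IsMonadMorphism M N θ × (∀ X → θ X ∘ ν X ≡ σ X)
                  × ((θ' : ∀ X → Hom (RawMonad.F₀ M X) (RawMonad.F₀ N X)) →
                     IsMonadMorphism M N θ' → (∀ X → θ' X ∘ ν X ≡ σ X) →
                     ∀ X → θ' X ≡ θ X)

  record Coproducts : Set (o ⊔ ℓ) where
    infixr 6 _+_
    field
      _+_   : Obj → Obj → Obj
      i₁    : ∀ {A B} → Hom A (A + B)
      i₂    : ∀ {A B} → Hom B (A + B)
      [_,_] : ∀ {A B X} → Hom A X → Hom B X → Hom (A + B) X
      inject₁ : ∀ {A B X} (f : Hom A X) (g : Hom B X) → [ f , g ] ∘ i₁ ≡ f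
      inject₂ : ∀ {A B X} (f : Hom A X) (g : Hom B X) → [ f , g ] ∘ i₂ ≡ g
      unique  : ∀ {A B X} (f : Hom A X) (g : Hom B X) (k : Hom (A + B) X) →
                k ∘ i₁ ≡ f → k ∘ i₂ ≡ g → [ f , g ] ≡ k

-- Kleisli category of a (raw) monad: morphisms X ⊸ Y are X → TY

Kleisli : ∀ {o ℓ} (C : RawCat o ℓ) → RawMonad C → RawCat o ℓ
Kleisli C T = record
  { Obj = Obj
  ; Hom = λ X Y → Hom X (F₀ Y)
  ; id  = λ {X} → unit X
  ; _∘_ = λ {X} {Y} {Z} g f → mult Z ∘ (F₁ g ∘ f)
  }
  where open RawCat C
        open RawMonad T

record Setting (o ℓ r : Level) : Set (lsuc (o ⊔ ℓ ⊔ r)) where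
  field
    C      : RawCat o ℓ
    C-cat  : IsCategory C
    T      : RawMonad C
    T-mon  : IsMonad C T
    cop    : Coproducts C

  open RawCat C
  open Coproducts cop

  Kl : RawCat o ℓ
  Kl = Kleisli C T

  KHom : Obj → Obj → Set ℓ
  KHom = RawCat.Hom Kl

  infixr 9 _·_
  _·_ : ∀ {X Y Z} → KHom Y Z → KHom X Y → KHom X Z
  _·_ = RawCat._∘_ Kl

  1ₖ : ∀ {X} → KHom X X
  1ₖ = RawCat.id Kl

  _♯ : ∀ {X Y} → Hom X Y → KHom X Y
  _♯ {Y = Y} f = RawMonad.unit T Y ∘ f

  ι¹ : ∀ {A B} → KHom A (A + B)
  ι¹ = i₁ ♯
  ι² : ∀ {A B} → KHom B (A + B)
  ι² = i₂ ♯
  [_,_]ₖ : ∀ {A B X} → KHom A X → KHom B X → KHom (A + B) X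
  [ f , g ]ₖ = [ f , g ]
  _⊕_ : ∀ {A B A' B'} → KHom A A' → KHom B B' → KHom (A + B) (A' + B')
  f ⊕ g = [ ι¹ · f , ι² · g ]ₖ

  field
    _≤_     : ∀ {X Y} → KHom X Y → KHom X Y → Set r
    ≤-po    : ∀ {X Y} → IsPartialOrder _≡_ (_≤_ {X} {Y})
    ·-mono  : ∀ {X Y Z} {f f' : KHom X Y} {g g' : KHom Y Z} →
              f ≤ f' → g ≤ g' → (g · f) ≤ (g' · f')
    _*      : ∀ {X} → KHom X X → KHom X X
    sat-a   : ∀ {X} (α : KHom X X) → 1ₖ ≤ (α *)
    sat-b   : ∀ {X} (α : KHom X X) → α ≤ (α *)
    sat-c   : ∀ {X} (α : KHom X X) → ((α *) · (α *)) ≤ (α *)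
    sat-d   : ∀ {X} (α β : KHom X X) → 1ₖ ≤ β → α ≤ β → (β · β) ≤ β → (α *) ≤ β
    sat-e≤  : ∀ {X Y} (f : Hom X Y) (α : KHom X X) (β : KHom Y Y) →
              ((f ♯) · α) ≤ (β · (f ♯)) → ((f ♯) · (α *)) ≤ ((β *) · (f ♯))
    sat-e≥  : ∀ {X Y} (f : Hom X Y) (α : KHom X X) (β : KHom Y Y) →
              (β · (f ♯)) ≤ ((f ♯) · α) → ((β *) · (f ♯)) ≤ ((f ♯) · (α *))
    0ₖ      : ∀ {X Y} → KHom X Y
    0-right : ∀ {X Y Z} (f : KHom Y Z) → f · 0ₖ {X} {Y} ≡ 0ₖ
    0-left  : ∀ {X Y Z} (g : KHom X Y) → 0ₖ {Y} {Z} · g ≡ 0ₖ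
    F       : RawEndo C
    F-fun   : IsFunctor C F
    F̄₁      : ∀ {X Y} → KHom X Y → KHom (RawEndo.F₀ F X) (RawEndo.F₀ F Y)

  F̄ : RawEndo Kl
  F̄ = record { F₀ = RawEndo.F₀ F ; F₁ = F̄₁ }

  field
    F̄-fun   : IsFunctor Kl F̄
    F̄-lift  : ∀ {X Y} (f : Hom X Y) → F̄₁ (f ♯) ≡ (RawEndo.F₁ F f) ♯

  Fτ₀ : Obj → Obj
  Fτ₀ X = RawEndo.F₀ F X + X

  Fτ̄ : RawMonad Kl
  Fτ̄ = record
    { endo = record { F₀ = Fτ₀ ; F₁ = λ α → F̄₁ α ⊕ α }
    ; unit = λ X → ι²
    ; mult = λ X → [ ι¹ , 1ₖ ]ₖ · (F̄₁ [ 0ₖ , 1ₖ ]ₖ ⊕ 1ₖ)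
    }

  m' : ∀ X → KHom (Fτ₀ (Fτ₀ X)) (Fτ₀ X)
  m' = RawMonad.mult Fτ̄
  e' : ∀ X → KHom X (Fτ₀ X)
  e' = RawMonad.unit Fτ̄

  field
    F*C     : RawMonad C
    F*C-free : Σ (∀ X → Hom (RawEndo.F₀ F X) (RawMonad.F₀ F*C X)) λ κ →
               IsFreeMonadOver C F F*C κ
    F̄*₁     : ∀ {X Y} → KHom X Y → KHom (RawMonad.F₀ F*C X) (RawMonad.F₀ F*C Y)
    F̄*-lift : ∀ {X Y} (f : Hom X Y) → F̄*₁ (f ♯) ≡ (RawMonad.F₁ F*C f) ♯
    m       : ∀ X → KHom (RawMonad.F₀ F*C (RawMonad.F₀ F*C X)) (RawMonad.F₀ F*C X)
    e       : ∀ X → KHom X (RawMonad.F₀ F*C X)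
    ν       : ∀ X → KHom (RawEndo.F₀ F X) (RawMonad.F₀ F*C X)

  F*₀ : Obj → Obj
  F*₀ = RawMonad.F₀ F*C

  F̄* : RawMonad Kl
  F̄* = record { endo = record { F₀ = F*₀ ; F₁ = F̄*₁ } ; unit = e ; mult = m }

  field
    F̄*-free : IsFreeMonadOver Kl F̄ F̄* ν
    Fτ̄-mono : ∀ {X Y} {α β : KHom X Y} → α ≤ β → RawMonad.F₁ Fτ̄ α ≤ RawMonad.F₁ Fτ̄ β
    F̄*-mono : ∀ {X Y} {α β : KHom X Y} → α ≤ β → F̄*₁ α ≤ F̄*₁ β
    Fτ̄-sat  : ∀ {X} (α : KHom X (Fτ₀ X)) →
              m' X · RawMonad.F₁ Fτ̄ (((m' X · RawMonad.F₁ Fτ̄ α) *) · e' X)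
                ≡ (m' X · RawMonad.F₁ Fτ̄ α) *
    F̄*-sat  : ∀ {X} (α : KHom X (F*₀ X)) →
              m X · F̄*₁ (((m X · F̄*₁ α) *) · e X) ≡ (m X · F̄*₁ α) *

  _★ : ∀ {X} → KHom X (Fτ₀ X) → KHom X (Fτ₀ X)
  _★ {X} α = ((m' X · RawMonad.F₁ Fτ̄ α) *) · e' X

  _⊛ : ∀ {Y} → KHom Y (F*₀ Y) → KHom Y (F*₀ Y)
  _⊛ {Y} β = ((m Y · F̄*₁ β) *) · e Y

  field
    h        : ∀ X → KHom (F*₀ X) (Fτ₀ X)
    h-mm     : IsMonadMorphism Kl F̄* Fτ̄ h
    h-ν      : ∀ X → h X · ν X ≡ ι¹
    h-unique : (θ : ∀ X → KHom (F*₀ X) (Fτ₀ X)) → IsMonadMorphism Kl F̄* Fτ̄ θ →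
               (∀ X → θ X · ν X ≡ ι¹) → ∀ X → θ X ≡ h X
    h-e      : ∀ X → h X · e X ≡ e' X
    h-[ν,e]  : ∀ X → h X · [ ν X , e X ]ₖ ≡ 1ₖ

  underline : ∀ {X} → KHom X (Fτ₀ X) → KHom X (F*₀ X)
  underline {X} α = [ ν X , e X ]ₖ · α

-- The monad morphism h intertwines the Kleisli extensions m ∘ F̄*(α̲) and m' ∘ F̄τ(α),
-- because h · α̲ = α.  The hypothesis transports this square to the saturations,
-- and precomposing with the units (h · e = e') gives the claim.
module Submission where

open import Defs
open import Relation.Binary.PropositionalEquality using (_≡_; sym; trans; cong; module ≡-Reasoning)

module _ {o ℓ} {C : RawCat o ℓ} (C-cat : IsCategory C) (T : RawMonad C) (T-mon : IsMonad C T) where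
  open RawCat C
  open IsCategory C-cat
  open RawMonad T
  open IsMonad T-mon
  open IsFunctor functor
  open ≡-Reasoning

  private
    infixr 9 _⊙_
    _⊙_ : ∀ {X Y Z} → Hom Y (F₀ Z) → Hom X (F₀ Y) → Hom X (F₀ Z)
    _⊙_ = RawCat._∘_ (Kleisli C T)

  Kleisli-identityˡ : ∀ {X Y} (f : Hom X (F₀ Y)) → unit Y ⊙ f ≡ f
  Kleisli-identityˡ {Y = Y} f = begin
    mult Y ∘ (F₁ (unit Y) ∘ f)  ≡⟨ sym (assoc _ _ _) ⟩
    (mult Y ∘ F₁ (unit Y)) ∘ f  ≡⟨ cong (_∘ f) (unit-left Y) ⟩
    id ∘ f                      ≡⟨ identityˡ f ⟩
    f                           ∎

  Kleisli-identityʳ : ∀ {X Y} (f : Hom X (F₀ Y)) → f ⊙ unit X ≡ f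
  Kleisli-identityʳ {X} {Y} f = begin
    mult Y ∘ (F₁ f ∘ unit X)      ≡⟨ cong (mult Y ∘_) (sym (unit-nat f)) ⟩
    mult Y ∘ (unit (F₀ Y) ∘ f)    ≡⟨ sym (assoc _ _ _) ⟩
    (mult Y ∘ unit (F₀ Y)) ∘ f    ≡⟨ cong (_∘ f) (unit-right Y) ⟩
    id ∘ f                        ≡⟨ identityˡ f ⟩
    f                             ∎

  Kleisli-assoc : ∀ {A B D E} (f : Hom A (F₀ B)) (g : Hom B (F₀ D)) (k : Hom D (F₀ E)) →
                  (k ⊙ g) ⊙ f ≡ k ⊙ (g ⊙ f)
  Kleisli-assoc {D = D} {E} f g k = begin
    mult E ∘ (F₁ (mult E ∘ (F₁ k ∘ g)) ∘ f)
      ≡⟨ cong (λ z → mult E ∘ (z ∘ f)) (trans (F-∘ _ _) (cong (F₁ (mult E) ∘_) (F-∘ _ _))) ⟩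
    mult E ∘ ((F₁ (mult E) ∘ (F₁ (F₁ k) ∘ F₁ g)) ∘ f)
      ≡⟨ cong (mult E ∘_) (assoc _ _ _) ⟩
    mult E ∘ (F₁ (mult E) ∘ ((F₁ (F₁ k) ∘ F₁ g) ∘ f))
      ≡⟨ sym (assoc _ _ _) ⟩
    (mult E ∘ F₁ (mult E)) ∘ ((F₁ (F₁ k) ∘ F₁ g) ∘ f)
      ≡⟨ cong (_∘ ((F₁ (F₁ k) ∘ F₁ g) ∘ f)) (mult-assoc E) ⟩
    (mult E ∘ mult (F₀ E)) ∘ ((F₁ (F₁ k) ∘ F₁ g) ∘ f)
      ≡⟨ assoc _ _ _ ⟩
    mult E ∘ (mult (F₀ E) ∘ ((F₁ (F₁ k) ∘ F₁ g) ∘ f))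
      ≡⟨ cong (λ z → mult E ∘ (mult (F₀ E) ∘ z)) (assoc _ _ _) ⟩
    mult E ∘ (mult (F₀ E) ∘ (F₁ (F₁ k) ∘ (F₁ g ∘ f)))
      ≡⟨ cong (mult E ∘_) (sym (assoc _ _ _)) ⟩
    mult E ∘ ((mult (F₀ E) ∘ F₁ (F₁ k)) ∘ (F₁ g ∘ f))
      ≡⟨ cong (λ z → mult E ∘ (z ∘ (F₁ g ∘ f))) (mult-nat k) ⟩
    mult E ∘ ((F₁ k ∘ mult D) ∘ (F₁ g ∘ f))
      ≡⟨ cong (mult E ∘_) (assoc _ _ _) ⟩
    mult E ∘ (F₁ k ∘ (mult D ∘ (F₁ g ∘ f)))
      ∎

  Kleisli-isCategory : IsCategory (Kleisli C T)
  Kleisli-isCategory = record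
    { identityˡ = Kleisli-identityˡ
    ; identityʳ = Kleisli-identityʳ
    ; assoc     = Kleisli-assoc
    }

module _ {o ℓ} {D : RawCat o ℓ} (D-cat : IsCategory D) where
  open RawCat D
  open IsCategory D-cat
  open ≡-Reasoning

  monadMorphism-extend : (M N : RawMonad D) → IsFunctor D (RawMonad.endo M) →
    (θ : ∀ X → Hom (RawMonad.F₀ M X) (RawMonad.F₀ N X)) → IsMonadMorphism D M N θ →
    ∀ {X Y} (β : Hom X (RawMonad.F₀ M Y)) →
    θ Y ∘ (RawMonad.mult M Y ∘ RawMonad.F₁ M β)
      ≡ (RawMonad.mult N Y ∘ RawMonad.F₁ N (θ Y ∘ β)) ∘ θ X
  monadMorphism-extend M N M-fun θ θ-mm {X} {Y} β = begin
    θ Y ∘ (μᴹ Y ∘ M₁ β)                       ≡⟨ sym (assoc _ _ _) ⟩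
    (θ Y ∘ μᴹ Y) ∘ M₁ β                       ≡⟨ cong (_∘ M₁ β) (pres-mult Y) ⟩
    (μᴺ Y ∘ (N₁ (θ Y) ∘ θ (M₀ Y))) ∘ M₁ β     ≡⟨ cong (λ z → (μᴺ Y ∘ z) ∘ M₁ β) (sym (natural (θ Y))) ⟩
    (μᴺ Y ∘ (θ (N₀ Y) ∘ M₁ (θ Y))) ∘ M₁ β     ≡⟨ assoc _ _ _ ⟩
    μᴺ Y ∘ ((θ (N₀ Y) ∘ M₁ (θ Y)) ∘ M₁ β)     ≡⟨ cong (μᴺ Y ∘_) (assoc _ _ _) ⟩
    μᴺ Y ∘ (θ (N₀ Y) ∘ (M₁ (θ Y) ∘ M₁ β))     ≡⟨ cong (λ z → μᴺ Y ∘ (θ (N₀ Y) ∘ z)) (sym (F-∘ β (θ Y))) ⟩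
    μᴺ Y ∘ (θ (N₀ Y) ∘ M₁ (θ Y ∘ β))          ≡⟨ cong (μᴺ Y ∘_) (natural (θ Y ∘ β)) ⟩
    μᴺ Y ∘ (N₁ (θ Y ∘ β) ∘ θ X)               ≡⟨ sym (assoc _ _ _) ⟩
    (μᴺ Y ∘ N₁ (θ Y ∘ β)) ∘ θ X               ∎
    where
    open RawMonad M using () renaming (F₀ to M₀; F₁ to M₁; mult to μᴹ)
    open RawMonad N using () renaming (F₀ to N₀; F₁ to N₁; mult to μᴺ)
    open IsFunctor M-fun
    open IsMonadMorphism θ-mm

lemma2 : ∀ {o ℓ r} (S : Setting o ℓ r) → let open Setting S in
    (∀ X (φ : KHom (F*₀ X) (F*₀ X)) (ψ : KHom (Fτ₀ X) (Fτ₀ X)) →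
    ψ · h X ≡ h X · φ → (ψ *) · h X ≡ h X · (φ *)) →
    ∀ X (α : KHom X (Fτ₀ X)) → h X · (underline α ⊛) ≡ α ★
lemma2 S sat-transfer X α = begin
    h X · ((φ *) · e X)   ≡⟨ sym (assoc _ _ _) ⟩
    (h X · (φ *)) · e X   ≡⟨ cong (_· e X) (sym (sat-transfer X φ ψ h-intertwines)) ⟩
    ((ψ *) · h X) · e X   ≡⟨ assoc _ _ _ ⟩
    (ψ *) · (h X · e X)   ≡⟨ cong ((ψ *) ·_) (h-e X) ⟩
    (ψ *) · e' X          ∎
  where
  open Setting S
  Kl-cat : IsCategory Kl
  Kl-cat = Kleisli-isCategory C-cat T T-mon

  open IsCategory Kl-cat
  open ≡-Reasoning

  φ : KHom (F*₀ X) (F*₀ X)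
  φ = m X · F̄*₁ (underline α)

  ψ : KHom (Fτ₀ X) (Fτ₀ X)
  ψ = m' X · RawMonad.F₁ Fτ̄ α

  h-underline : h X · underline α ≡ α
  h-underline = begin
    h X · ([ ν X , e X ]ₖ · α)   ≡⟨ sym (assoc _ _ _) ⟩
    (h X · [ ν X , e X ]ₖ) · α   ≡⟨ cong (_· α) (h-[ν,e] X) ⟩
    1ₖ · α                       ≡⟨ identityˡ α ⟩
    α                            ∎

  h-intertwines : ψ · h X ≡ h X · φ
  h-intertwines = sym (trans
    (monadMorphism-extend Kl-cat F̄* Fτ̄
      (IsMonad.functor (IsFreeMonadOver.isMonad F̄*-free)) h h-mm (underline α))
    (cong (λ β → (m' X · RawMonad.F₁ Fτ̄ β) · h X) h-underline))
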